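{- Let $q\ge 2$. For every positive integer $n$, $\phi(H_{n,q})\le \min\{q-1,n\}$.
   Context: The Hamming graph $H_{n,q}$ has vertex set $\{0,1,\dots,q-1\}^n$, two vertices adjacent iff they differ in exactly one coordinate, so $d(u,v)$ is the number of coordinates where $u,v$ differ. A pair $\{x,y\}$ doubly resolves $\{u,v\}$ if $d(u,x)-d(u,y)\neq d(v,x)-d(v,y)$. For a vertex $x$ of a graph $G$, $T\subseteq V(G)$ is a doubly distance resolving set of $G$ on $x$ if every pair $\{u,v\}$ with $d_G(u,x)\neq d_G(v,x)$ is doubly resolved by some pair of vertices of $T\cup\{x\}$; $\phi(G,x)$ is the minimum size of such a set, and $\phi(G)=\max\{\phi(G,x):x\in V(G)\}$. -}

module Defs where

open import Data.Nat using (ℕ; zero; suc; _+_)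
open import Data.Fin using (Fin)
import Data.Fin as Fin
open import Data.Integer using (ℤ; _-_; +_)
open import Data.List using (List; _∷_)
open import Data.List.Membership.Propositional using (_∈_)
open import Data.Product using (∃₂; _×_)
open import Relation.Nullary using (yes; no; ¬_)
open import Relation.Binary.PropositionalEquality using (_≡_)

-- Vertices of the Hamming graph H_{n,q}: words of length n over {0,…,q-1}.
Word : ℕ → ℕ → Set
Word n q = Fin n → Fin q

-- Hamming distance = graph distance in H_{n,q}: number of differing coordinates.
dist : ∀ {n q} → Word n q → Word n q → ℕ
dist {zero}  u v = 0
dist {suc n} u v with u Fin.zero Fin.≟ v Fin.zero
... | yes _ = dist {n} (λ i → u (Fin.suc i)) (λ i → v (Fin.suc i))
... | no  _ = suc (dist {n} (λ i → u (Fin.suc i)) (λ i → v (Fin.suc i)))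

DoublyResolves : ∀ {n q} → Word n q → Word n q → Word n q → Word n q → Set
DoublyResolves a b u v =
  ¬ ((+ dist u a) - (+ dist u b) ≡ (+ dist v a) - (+ dist v b))

IsDDRSOn : ∀ {n q} → Word n q → List (Word n q) → Set
IsDDRSOn {n} {q} x T =
  (u v : Word n q) → ¬ (dist u x ≡ dist v x) →
  ∃₂ λ a b → a ∈ (x ∷ T) × b ∈ (x ∷ T) × DoublyResolves a b u v

-- Write the alphabet as Fin (1 + q) and fix an injection g : Fin m → Fin q. For a vertex x
-- take the m probes t_j with (t_j)_i = punchIn x_i (g j): at every coordinate the probes
-- use m distinct letters, all different from x_i. If no pair {x, t_j} doubly resolves
-- {u, v}, summing the m equations d(u,x) - d(u,t_j) = d(v,x) - d(v,t_j) and counting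
-- agreements coordinatewise gives  m d(u,x) + c(u) = m d(v,x) + c(v),  where c(u) counts
-- the coordinates at which u agrees with some probe, so c(u) ≤ d(u,x). With m = q (g a
-- bijection) c(u) = d(u,x), and with m = n the distances are at most m; either way the
-- equation forces d(u,x) = d(v,x). Taking m = min(q, n) gives the bound.
module Submission where

open import Defs
open import Data.Bool.Base using (true; false; if_then_else_)
open import Data.Fin.Base using (Fin; zero; suc; punchIn; punchOut; inject≤)
open import Data.Fin.Properties
  using (_≟_; 0≢1+n; suc-injective; punchInᵢ≢i; punchIn-injective; punchIn-punchOut;
         inject≤-injective; any?; all?; ¬∀⟶∃¬)
import Data.Integer as ℤ
open import Data.Integer.Properties using (+-injective)
open import Data.Integer.Tactic.RingSolver using (solve-∀)
open import Data.Nat.Tactic.RingSolver renaming (solve-∀ to nsolve-∀)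
open import Data.List using (List; length; tabulate)
open import Data.List.Properties using (length-tabulate)
open import Data.List.Membership.Propositional.Properties using (∈-tabulate⁺)
open import Data.List.Relation.Unary.Any using (here; there)
open import Data.Nat.Base using (ℕ; zero; suc; _+_; _*_; _≤_; _<_; _⊓_; _∸_; z≤n; s≤s)
open import Data.Nat.Properties
  using (≤-refl; ≤-reflexive; ≤-total; <-≤-trans; <-cmp; <⇒≢; m≤m+n; +-comm; +-mono-≤;
         +-monoʳ-≤; +-monoʳ-<; +-cancelʳ-≡; *-suc; *-identityʳ; *-monoʳ-≤; *-cancelˡ-≡;
         ⊓-glb; +-0-commutativeMonoid; module ≤-Reasoning)
open import Data.Product using (Σ; ∃; _×_; _,_)
open import Data.Sum using (_⊎_; inj₁; inj₂)
open import Function using (_∘_; id)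
open import Function.Definitions using (Injective)
open import Relation.Binary.Definitions using (tri<; tri≈; tri>)
open import Relation.Binary.PropositionalEquality
open import Relation.Nullary using (does; yes; no; contradiction)
open import Relation.Unary using (Decidable)
open import Relation.Nullary.Decidable using (dec-true; dec-false)

open import Algebra.Properties.CommutativeMonoid.Sum +-0-commutativeMonoid
  using (sum-syntax; ∑-distrib-+; ∑-comm; sum-cong-≗)

∑-const : ∀ m c → ∑[ j < m ] c ≡ m * c
∑-const zero    c = refl
∑-const (suc m) c = cong (c +_) (∑-const m c)

∑-const-+ : ∀ m c (f : Fin m → ℕ) → ∑[ j < m ] (c + f j) ≡ m * c + ∑[ j < m ] f j
∑-const-+ m c f = trans (∑-distrib-+ (λ _ → c) f) (cong (_+ ∑[ j < m ] f j) (∑-const m c))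

∑-mono-≤ : ∀ {m} {f g : Fin m → ℕ} → (∀ j → f j ≤ g j) → ∑[ j < m ] f j ≤ ∑[ j < m ] g j
∑-mono-≤ {zero}  f≤g = z≤n
∑-mono-≤ {suc m} f≤g = +-mono-≤ (f≤g zero) (∑-mono-≤ (f≤g ∘ suc))

match mismatch : ∀ {q} → Fin q → Fin q → ℕ
match    a b = if does (a ≟ b) then 1 else 0
mismatch a b = if does (a ≟ b) then 0 else 1

match-refl : ∀ {q} (a : Fin q) → match a a ≡ 1
match-refl a rewrite dec-true (a ≟ a) refl = refl

match-≢ : ∀ {q} {a b : Fin q} → a ≢ b → match a b ≡ 0
match-≢ {a = a} {b} a≢b rewrite dec-false (a ≟ b) a≢b = refl

mismatch+match≡1 : ∀ {q} (a b : Fin q) → mismatch a b + match a b ≡ 1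
mismatch+match≡1 a b with does (a ≟ b)
... | true  = refl
... | false = refl

dist≡∑mismatch : ∀ {n q} (u v : Word n q) → dist u v ≡ ∑[ i < n ] mismatch (u i) (v i)
dist≡∑mismatch {zero}  u v = refl
dist≡∑mismatch {suc n} u v with u zero ≟ v zero
... | yes _ = dist≡∑mismatch (u ∘ suc) (v ∘ suc)
... | no  _ = cong suc (dist≡∑mismatch (u ∘ suc) (v ∘ suc))

agreements : ∀ {n q} → Word n q → Word n q → ℕ
agreements {n} u v = ∑[ i < n ] match (u i) (v i)

dist+agreements≡n : ∀ {n q} (u v : Word n q) → dist u v + agreements u v ≡ n
dist+agreements≡n {n} u v = begin
  dist u v + agreements u v
    ≡⟨ cong (_+ agreements u v) (dist≡∑mismatch u v) ⟩
  ∑[ i < n ] mismatch (u i) (v i) + agreements u v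
    ≡⟨ ∑-distrib-+ (λ i → mismatch (u i) (v i)) (λ i → match (u i) (v i)) ⟨
  ∑[ i < n ] (mismatch (u i) (v i) + match (u i) (v i))
    ≡⟨ sum-cong-≗ (λ i → mismatch+match≡1 (u i) (v i)) ⟩
  ∑[ i < n ] 1
    ≡⟨ ∑-const n 1 ⟩
  n * 1
    ≡⟨ *-identityʳ n ⟩
  n ∎
  where open ≡-Reasoning

dist≤n : ∀ {n q} (u v : Word n q) → dist u v ≤ n
dist≤n u v = subst (dist u v ≤_) (dist+agreements≡n u v) (m≤m+n _ _)

∑match-absent : ∀ {m q} {h : Fin m → Fin q} {a} → (∀ j → a ≢ h j) → ∑[ j < m ] match a (h j) ≡ 0
∑match-absent {zero}  _    = refl
∑match-absent {suc m} miss = cong₂ _+_ (match-≢ (miss zero)) (∑match-absent (miss ∘ suc))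

∑match-hit : ∀ {m q} {h : Fin m → Fin q} → Injective _≡_ _≡_ h →
             ∀ j → ∑[ k < m ] match (h j) (h k) ≡ 1
∑match-hit {suc m} {h = h} h-inj zero    =
  cong₂ _+_ (match-refl (h zero)) (∑match-absent {h = h ∘ suc} (λ k e → 0≢1+n (h-inj e)))
∑match-hit {suc m} {h = h} h-inj (suc j) =
  cong₂ _+_ (match-≢ (λ e → 0≢1+n (sym (h-inj e))))
            (∑match-hit (suc-injective ∘ h-inj) j)

∑match-injective-≤1 : ∀ {m q} {h : Fin m → Fin q} → Injective _≡_ _≡_ h →
                      ∀ a → ∑[ j < m ] match a (h j) ≤ 1
∑match-injective-≤1 {h = h} h-inj a with any? (λ j → h j ≟ a)
... | yes (j , refl) = ≤-reflexive (∑match-hit h-inj j)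
... | no  absent     =
  subst (_≤ 1) (sym (∑match-absent (λ j e → absent (j , sym e)))) z≤n

m-n≡o-p⇒m+p≡o+n : ∀ m n o p → ℤ.+ m ℤ.- ℤ.+ n ≡ ℤ.+ o ℤ.- ℤ.+ p → m + p ≡ o + n
m-n≡o-p⇒m+p≡o+n m n o p eq = +-injective (begin
  ℤ.+ m ℤ.+ ℤ.+ p                          ≡⟨ regroup (ℤ.+ m) (ℤ.+ n) (ℤ.+ p) ⟩
  (ℤ.+ m ℤ.- ℤ.+ n) ℤ.+ (ℤ.+ n ℤ.+ ℤ.+ p)  ≡⟨ cong (ℤ._+ (ℤ.+ n ℤ.+ ℤ.+ p)) eq ⟩
  (ℤ.+ o ℤ.- ℤ.+ p) ℤ.+ (ℤ.+ n ℤ.+ ℤ.+ p)  ≡⟨ regroup′ (ℤ.+ o) (ℤ.+ n) (ℤ.+ p) ⟩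
  ℤ.+ o ℤ.+ ℤ.+ n                          ∎)
  where
  open ≡-Reasoning
  regroup : ∀ a b c → a ℤ.+ c ≡ (a ℤ.- b) ℤ.+ (b ℤ.+ c)
  regroup = solve-∀
  regroup′ : ∀ a b c → (a ℤ.- c) ℤ.+ (b ℤ.+ c) ≡ a ℤ.+ b
  regroup′ = solve-∀

trade-complements : ∀ a b c d {e f n} → a + d ≡ c + b → b + e ≡ n → d + f ≡ n → a + e ≡ c + f
trade-complements a b c d {e} {f} {n} a+d≡c+b b+e≡n d+f≡n = +-cancelʳ-≡ n _ _ (begin
  (a + e) + n        ≡⟨ cong ((a + e) +_) d+f≡n ⟨
  (a + e) + (d + f)  ≡⟨ swap a e d f ⟩
  (a + d) + (e + f)  ≡⟨ cong (_+ (e + f)) a+d≡c+b ⟩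
  (c + b) + (e + f)  ≡⟨ swap′ c b e f ⟩
  (c + f) + (b + e)  ≡⟨ cong ((c + f) +_) b+e≡n ⟩
  (c + f) + n        ∎)
  where
  open ≡-Reasoning
  swap : ∀ w x y z → (w + x) + (y + z) ≡ (w + y) + (x + z)
  swap = nsolve-∀
  swap′ : ∀ w x y z → (w + x) + (y + z) ≡ (w + z) + (x + y)
  swap′ = nsolve-∀

*-+-self-injective : ∀ m {d₁ d₂} → m * d₁ + d₁ ≡ m * d₂ + d₂ → d₁ ≡ d₂
*-+-self-injective m {d₁} {d₂} eq =
  *-cancelˡ-≡ d₁ d₂ (suc m) (trans (+-comm d₁ (m * d₁)) (trans eq (+-comm (m * d₂) d₂)))

*-+-<-mono : ∀ m {d₁ d₂ c₁ c₂} → c₁ ≤ d₁ → d₁ < d₂ → d₂ ≤ m → m * d₁ + c₁ < m * d₂ + c₂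
*-+-<-mono m {d₁} {d₂} {c₁} {c₂} c₁≤d₁ d₁<d₂ d₂≤m = begin-strict
  m * d₁ + c₁  ≤⟨ +-monoʳ-≤ (m * d₁) c₁≤d₁ ⟩
  m * d₁ + d₁  <⟨ +-monoʳ-< (m * d₁) (<-≤-trans d₁<d₂ d₂≤m) ⟩
  m * d₁ + m   ≡⟨ +-comm (m * d₁) m ⟩
  m + m * d₁   ≡⟨ *-suc m d₁ ⟨
  m * suc d₁   ≤⟨ *-monoʳ-≤ m d₁<d₂ ⟩
  m * d₂       ≤⟨ m≤m+n (m * d₂) c₂ ⟩
  m * d₂ + c₂  ∎
  where open ≤-Reasoning

*-+-cancel-bounded : ∀ m {d₁ d₂ c₁ c₂} → c₁ ≤ d₁ → c₂ ≤ d₂ → d₁ ≤ m → d₂ ≤ m →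
                     m * d₁ + c₁ ≡ m * d₂ + c₂ → d₁ ≡ d₂
*-+-cancel-bounded m {d₁} {d₂} c₁≤d₁ c₂≤d₂ d₁≤m d₂≤m eq with <-cmp d₁ d₂
... | tri< d₁<d₂ _ _ = contradiction eq (<⇒≢ (*-+-<-mono m c₁≤d₁ d₁<d₂ d₂≤m))
... | tri≈ _ d₁≡d₂ _ = d₁≡d₂
... | tri> _ _ d₂<d₁ = contradiction (sym eq) (<⇒≢ (*-+-<-mono m c₂≤d₂ d₂<d₁ d₁≤m))

module Probes {q m} (g : Fin m → Fin q) (g-injective : Injective _≡_ _≡_ g) where

  Onto : Set
  Onto = ∀ k → ∃ λ j → g j ≡ k

  hits : Fin (suc q) → Fin (suc q) → ℕ
  hits a c = ∑[ j < m ] match a (punchIn c (g j))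

  punchIn-g-injective : ∀ c → Injective _≡_ _≡_ (punchIn c ∘ g)
  punchIn-g-injective c = g-injective ∘ punchIn-injective c _ _

  hits-refl : ∀ a → hits a a ≡ 0
  hits-refl a = ∑match-absent (λ j → punchInᵢ≢i a (g j) ∘ sym)

  hits≤mismatch : ∀ a c → hits a c ≤ mismatch a c
  hits≤mismatch a c with a ≟ c
  ... | yes refl = ≤-reflexive (hits-refl a)
  ... | no  _    = ∑match-injective-≤1 (punchIn-g-injective c) a

  hits≡mismatch : Onto → ∀ a c → hits a c ≡ mismatch a c
  hits≡mismatch g-onto a c with a ≟ c
  ... | yes refl = hits-refl a
  ... | no  a≢c  with g-onto (punchOut (a≢c ∘ sym))
  ...   | j , gj≡k = subst (λ b → hits b c ≡ 1)
                       (trans (cong (punchIn c) gj≡k) (punchIn-punchOut (a≢c ∘ sym)))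
                       (∑match-hit (punchIn-g-injective c) j)

  probe : ∀ {n} → Word n (suc q) → Fin m → Word n (suc q)
  probe x j i = punchIn (x i) (g j)

  coincidences : ∀ {n} → Word n (suc q) → Word n (suc q) → ℕ
  coincidences x u = ∑[ j < m ] agreements u (probe x j)

  coincidences≡∑hits : ∀ {n} (x u : Word n (suc q)) → coincidences x u ≡ ∑[ i < n ] hits (u i) (x i)
  coincidences≡∑hits x u = ∑-comm (λ j i → match (u i) (probe x j i))

  coincidences≤dist : ∀ {n} (x u : Word n (suc q)) → coincidences x u ≤ dist u x
  coincidences≤dist {n} x u = begin
    coincidences x u                 ≡⟨ coincidences≡∑hits x u ⟩
    ∑[ i < n ] hits (u i) (x i)      ≤⟨ ∑-mono-≤ (λ i → hits≤mismatch (u i) (x i)) ⟩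
    ∑[ i < n ] mismatch (u i) (x i)  ≡⟨ dist≡∑mismatch u x ⟨
    dist u x                         ∎
    where open ≤-Reasoning

  coincidences≡dist : Onto → ∀ {n} (x u : Word n (suc q)) → coincidences x u ≡ dist u x
  coincidences≡dist g-onto x u = begin
    coincidences x u                 ≡⟨ coincidences≡∑hits x u ⟩
    ∑[ i < _ ] hits (u i) (x i)      ≡⟨ sum-cong-≗ (λ i → hits≡mismatch g-onto (u i) (x i)) ⟩
    ∑[ i < _ ] mismatch (u i) (x i)  ≡⟨ dist≡∑mismatch u x ⟨
    dist u x                         ∎
    where open ≡-Reasoning

  Unresolved : ∀ {n} (x u v : Word n (suc q)) → Fin m → Set
  Unresolved x u v j =
    ℤ.+ dist u x ℤ.- ℤ.+ dist u (probe x j) ≡ ℤ.+ dist v x ℤ.- ℤ.+ dist v (probe x j)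

  unresolved? : ∀ {n} (x u v : Word n (suc q)) → Decidable (Unresolved x u v)
  unresolved? x u v j = _ ℤ.≟ _

  balance : ∀ {n} (x u v : Word n (suc q)) → (∀ j → Unresolved x u v j) →
            m * dist u x + coincidences x u ≡ m * dist v x + coincidences x v
  balance x u v unresolved = begin
    m * dist u x + coincidences x u                   ≡⟨ ∑-const-+ m (dist u x) _ ⟨
    ∑[ j < m ] (dist u x + agreements u (probe x j))  ≡⟨ sum-cong-≗ trade ⟩
    ∑[ j < m ] (dist v x + agreements v (probe x j))  ≡⟨ ∑-const-+ m (dist v x) _ ⟩
    m * dist v x + coincidences x v                   ∎
    where
    open ≡-Reasoning
    trade : ∀ j → dist u x + agreements u (probe x j) ≡ dist v x + agreements v (probe x j)
    trade j = trade-complements (dist u x) (dist u t) (dist v x) (dist v t)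
      (m-n≡o-p⇒m+p≡o+n (dist u x) (dist u t) (dist v x) (dist v t) (unresolved j))
      (dist+agreements≡n u t) (dist+agreements≡n v t)
      where t = probe x j

  equidistant : ∀ {n} → m ≡ n ⊎ Onto → (x u v : Word n (suc q)) →
                (∀ j → Unresolved x u v j) → dist u x ≡ dist v x
  equidistant (inj₁ refl) x u v unresolved =
    *-+-cancel-bounded m (coincidences≤dist x u) (coincidences≤dist x v)
      (dist≤n u x) (dist≤n v x) (balance x u v unresolved)
  equidistant (inj₂ g-onto) x u v unresolved =
    *-+-self-injective m (subst₂ (λ cᵤ cᵥ → m * dist u x + cᵤ ≡ m * dist v x + cᵥ)
      (coincidences≡dist g-onto x u) (coincidences≡dist g-onto x v)
      (balance x u v unresolved))

  probes-resolve : ∀ {n} → m ≡ n ⊎ Onto →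
                   (x : Word n (suc q)) → IsDDRSOn x (tabulate (probe x))
  probes-resolve m≡n⊎onto x u v du≢dv with all? (unresolved? x u v)
  ... | yes unresolved = contradiction (equidistant m≡n⊎onto x u v unresolved) du≢dv
  ... | no  ¬unresolved with ¬∀⟶∃¬ m _ (unresolved? x u v) ¬unresolved
  ...   | j , resolves = x , probe x j , here refl , there (∈-tabulate⁺ j) , resolves

  probes-suffice : ∀ {n} → m ≡ n ⊎ Onto → m ≤ q ⊓ n →
                   (x : Word n (suc q)) →
                   Σ (List (Word n (suc q))) λ T → (length T ≤ q ⊓ n) × IsDDRSOn x T
  probes-suffice m≡n⊎onto m≤q⊓n x =
    tabulate (probe x) ,
    subst (_≤ _) (sym (length-tabulate (probe x))) m≤q⊓n ,
    probes-resolve m≡n⊎onto x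

lemma4 : (q n : ℕ) → 2 ≤ q → 1 ≤ n →
    (x : Word n q) →
    Σ (List (Word n q)) λ T → (length T ≤ (q ∸ 1) ⊓ n) × IsDDRSOn x T
lemma4 (suc (suc q)) n (s≤s (s≤s z≤n)) _ x with ≤-total n (suc q)
... | inj₁ n≤q = Probes.probes-suffice (λ j → inject≤ j n≤q)
                   (λ {i} {j} → inject≤-injective n≤q n≤q i j) (inj₁ refl) (⊓-glb n≤q ≤-refl) x
... | inj₂ q≤n = Probes.probes-suffice id id (inj₂ (λ k → k , refl)) (⊓-glb ≤-refl q≤n) x
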